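{- For every odd integer $n\ge 3$, the complement $\overline{C_n}$ of the cycle $C_n$ is $1$-perfectly orientable.
   Context: All graphs are finite and simple. An orientation of a graph $G$ is $1$-perfect if for every vertex $v$, its out-neighborhood is a clique in $G$; $G$ is $1$-perfectly orientable if it admits a $1$-perfect orientation. -}

module Defs where

open import Data.Nat using (ℕ; suc)
open import Data.Fin using (Fin; toℕ)
open import Data.Product using (Σ; _×_; _,_)
open import Data.Sum using (_⊎_; swap)
open import Relation.Nullary using (¬_)
open import Relation.Binary.PropositionalEquality using (_≡_; refl; sym)

record Graph (n : ℕ) : Set₁ where
  field
    Adj       : Fin n → Fin n → Set
    Adj-sym   : ∀ {u v} → Adj u v → Adj v u
    Adj-irr   : ∀ {v} → ¬ Adj v v

open Graph public

record Orientation {n : ℕ} (G : Graph n) : Set₁ where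
  field
    Arc        : Fin n → Fin n → Set
    Arc⊆Adj    : ∀ {u v} → Arc u v → Adj G u v
    Arc-total  : ∀ {u v} → Adj G u v → Arc u v ⊎ Arc v u
    Arc-asym   : ∀ {u v} → Arc u v → ¬ Arc v u

open Orientation public

Is1Perfect : {n : ℕ} (G : Graph n) → Orientation G → Set
Is1Perfect {n} G D =
  ∀ (v u w : Fin n) → Arc D v u → Arc D v w → ¬ (u ≡ w) → Adj G u w

OnePerfectlyOrientable : {n : ℕ} → Graph n → Set₁
OnePerfectlyOrientable G = Σ (Orientation G) (Is1Perfect G)

CycNext : (n : ℕ) → Fin n → Fin n → Set
CycNext n i j = (suc (toℕ i) ≡ toℕ j) ⊎ ((suc (toℕ i) ≡ n) × (toℕ j ≡ 0))

-- Cycle adjacency: i ~ j iff one is the cyclic successor of the other.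
-- For n ≥ 3 this is the cycle C_n on vertices 0,1,…,n-1 in cyclic order.
CycleAdj : (n : ℕ) → Fin n → Fin n → Set
CycleAdj n i j = CycNext n i j ⊎ CycNext n j i

ComplAdj : (n : ℕ) → Fin n → Fin n → Set
ComplAdj n i j = ¬ (i ≡ j) × ¬ CycleAdj n i j

CycleComplement : (n : ℕ) → Graph n
CycleComplement n = record
  { Adj     = ComplAdj n
  ; Adj-sym = λ { (i≢j , ¬c) → (λ e → i≢j (sym e)) , (λ c → ¬c (swap c)) }
  ; Adj-irr = λ { (i≢i , _) → i≢i refl }
  }

module Submission where

open import Defs
open import Data.Nat using (ℕ; _≤_; _*_; _+_; suc; _<_; _∸_; _≤?_; parity)
open import Relation.Binary.PropositionalEquality using (_≡_; _≢_; refl; sym; trans; cong; cong₂; module ≡-Reasoning)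

open import Data.Nat.Properties
  using (+-∸-assoc; m+[n∸m]≡n; +-cancelˡ-≡; +-suc; +-comm; +-assoc; +-identityʳ;
         ≤∧≢⇒<; ≤-<-connex; <⇒≤; <⇒≢; m≤n⇒m≤n+o; m≤n⇒m≤1+n; n≢0⇒n>0; <-cmp; ≤-trans; ≤-pred)
open import Data.Parity.Base as ℙ using (0ℙ; 1ℙ; _⁻¹)
open import Data.Parity.Properties using (+-homo-+; *-homo-*; suc-homo-⁻¹; p≢p⁻¹)
open import Data.Fin using (Fin; toℕ)
open import Data.Fin.Properties using (toℕ<n; toℕ-injective)
open import Data.Product using (_×_; _,_; proj₁)
open import Data.Sum using (_⊎_; inj₁; inj₂; [_,_]′)
open import Function using (_∘_)
open import Relation.Binary using (tri<; tri≈; tri>)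
open import Relation.Nullary using (¬_; yes; no; contradiction)

-- Place the vertices 0, …, n-1 of C_n around a circle and orient the edge uv as
-- u ⟶ v whenever v lies an even number of steps ahead of u. Since the two
-- forward distances between distinct vertices add up to the odd number n, exactly
-- one of them is even, so this orients every pair. If u and w are both an even
-- distance ahead of v then they cannot be consecutive on the cycle, because
-- moving one step forward changes the parity of the distance from v; so any two
-- out-neighbours of v are adjacent in the complement of C_n.

module _ {n : ℕ} (G : Graph n) (T : Fin n → Fin n → Set)
         (T-total : ∀ {u v} → Adj G u v → T u v ⊎ T v u)
         (T-asym : ∀ {u v} → Adj G u v → T u v → ¬ T v u) where

  restrictedOrientation : Orientation G
  restrictedOrientation = record
    { Arc       = λ u v → Adj G u v × T u v
    ; Arc⊆Adj   = proj₁
    ; Arc-total = λ u~v → [ (λ t → inj₁ (u~v , t)) , (λ t → inj₂ (Adj-sym G u~v , t)) ]′ (T-total u~v)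
    ; Arc-asym  = λ { (u~v , tuv) (_ , tvu) → T-asym u~v tuv tvu }
    }

Even : ℕ → Set
Even m = parity m ≡ 0ℙ

even-suc-not-even : ∀ m → Even m → ¬ Even (suc m)
even-suc-not-even m m-even sm-even =
  p≢p⁻¹ (parity (suc m)) (trans sm-even (trans (sym m-even) (sym (suc-homo-⁻¹ m))))

parity-2*k+1 : ∀ k → parity (2 * k + 1) ≡ 1ℙ
parity-2*k+1 k = trans (+-homo-+ (2 * k) 1) (cong (ℙ._+ 1ℙ) (*-homo-* 2 k))

odd-sum-parity : ∀ a b → parity (a + b) ≡ 1ℙ → parity a ≡ parity b ⁻¹
odd-sum-parity a b odd = helper (parity a) (parity b) (trans (sym (+-homo-+ a b)) odd)
  where
  helper : ∀ p q → p ℙ.+ q ≡ 1ℙ → p ≡ q ⁻¹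
  helper 0ℙ 1ℙ _ = refl
  helper 1ℙ 0ℙ _ = refl

odd-sum-even-or-even : ∀ a b → parity (a + b) ≡ 1ℙ → Even a ⊎ Even b
odd-sum-even-or-even a b odd with parity b in b-parity
... | 0ℙ = inj₂ refl
... | 1ℙ = inj₁ (trans (odd-sum-parity a b odd) (cong _⁻¹ b-parity))

odd-sum-not-even-and-even : ∀ a b → parity (a + b) ≡ 1ℙ → Even a → ¬ Even b
odd-sum-not-even-and-even a b odd a-even b-even
  with () ← trans (sym a-even) (trans (odd-sum-parity a b odd) (cong _⁻¹ b-even))

forwardDistance : ℕ → ℕ → ℕ → ℕ
forwardDistance n x y with x ≤? y
... | yes _ = y ∸ x
... | no  _ = n + y ∸ x

forwardDistance-≤ : ∀ n {x y} → x ≤ y → forwardDistance n x y ≡ y ∸ x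
forwardDistance-≤ n {x} {y} x≤y with x ≤? y
... | yes _   = refl
... | no  x≰y = contradiction x≤y x≰y

forwardDistance-> : ∀ n {x y} → y < x → forwardDistance n x y ≡ n + y ∸ x
forwardDistance-> n {x} {y} y<x with x ≤? y
... | yes x≤y = contradiction (≤-trans y<x x≤y) (λ y<y → <⇒≢ y<y refl)
... | no  _   = refl

forwardDistance-+-< : ∀ {n x y} → x < y → y < n →
                      forwardDistance n x y + forwardDistance n y x ≡ n
forwardDistance-+-< {n} {x} {y} x<y y<n = +-cancelˡ-≡ x _ _ (begin
  x + (forwardDistance n x y + forwardDistance n y x) ≡⟨ cong (x +_) (cong₂ _+_ (forwardDistance-≤ n (<⇒≤ x<y)) (forwardDistance-> n x<y)) ⟩
  x + ((y ∸ x) + (n + x ∸ y))                        ≡⟨ sym (+-assoc x (y ∸ x) _) ⟩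
  x + (y ∸ x) + (n + x ∸ y)                          ≡⟨ cong (_+ (n + x ∸ y)) (m+[n∸m]≡n (<⇒≤ x<y)) ⟩
  y + (n + x ∸ y)                                    ≡⟨ m+[n∸m]≡n (m≤n⇒m≤n+o x (<⇒≤ y<n)) ⟩
  n + x                                              ≡⟨ +-comm n x ⟩
  x + n                                              ∎)
  where
  open ≡-Reasoning

forwardDistance-+ : ∀ {n x y} → x ≢ y → x < n → y < n →
                    forwardDistance n x y + forwardDistance n y x ≡ n
forwardDistance-+ {n} {x} {y} x≢y x<n y<n with <-cmp x y
... | tri< x<y _ _ = forwardDistance-+-< x<y y<n
... | tri≈ _ x≡y _ = contradiction x≡y x≢y
... | tri> _ _ y<x = trans (+-comm (forwardDistance n x y) _) (forwardDistance-+-< y<x x<n)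

forwardDistance-suc : ∀ {n x u} → x < n → suc u ≢ x →
                      forwardDistance n x (suc u) ≡ suc (forwardDistance n x u)
forwardDistance-suc {n} {x} {u} x<n 1+u≢x with ≤-<-connex x u
... | inj₁ x≤u = begin
  forwardDistance n x (suc u) ≡⟨ forwardDistance-≤ n (m≤n⇒m≤1+n x≤u) ⟩
  suc u ∸ x                   ≡⟨ +-∸-assoc 1 x≤u ⟩
  suc (u ∸ x)                 ≡⟨ cong suc (forwardDistance-≤ n x≤u) ⟨
  suc (forwardDistance n x u) ∎
  where open ≡-Reasoning
... | inj₂ u<x = begin
  forwardDistance n x (suc u) ≡⟨ forwardDistance-> n (≤∧≢⇒< u<x 1+u≢x) ⟩
  n + suc u ∸ x               ≡⟨ cong (_∸ x) (+-suc n u) ⟩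
  suc (n + u) ∸ x             ≡⟨ +-∸-assoc 1 (m≤n⇒m≤n+o u (<⇒≤ x<n)) ⟩
  suc (n + u ∸ x)             ≡⟨ cong suc (forwardDistance-> n u<x) ⟨
  suc (forwardDistance n x u) ∎
  where open ≡-Reasoning

forwardDistance-wrap : ∀ {x u} → 0 < x → x ≤ u →
                       forwardDistance (suc u) x 0 ≡ suc (forwardDistance (suc u) x u)
forwardDistance-wrap {x} {u} 0<x x≤u = begin
  forwardDistance (suc u) x 0 ≡⟨ forwardDistance-> (suc u) 0<x ⟩
  suc u + 0 ∸ x               ≡⟨ cong (_∸ x) (+-identityʳ (suc u)) ⟩
  suc u ∸ x                   ≡⟨ +-∸-assoc 1 x≤u ⟩
  suc (u ∸ x)                 ≡⟨ cong suc (forwardDistance-≤ (suc u) x≤u) ⟨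
  suc (forwardDistance (suc u) x u) ∎
  where open ≡-Reasoning

forwardDistance-next : ∀ {n x u w} → x < n → w ≢ x → (suc u ≡ w) ⊎ (suc u ≡ n × w ≡ 0) →
                       forwardDistance n x w ≡ suc (forwardDistance n x u)
forwardDistance-next x<n w≢x (inj₁ refl)         = forwardDistance-suc x<n w≢x
forwardDistance-next x<n w≢x (inj₂ (refl , refl)) =
  forwardDistance-wrap (n≢0⇒n>0 (λ x≡0 → w≢x (sym x≡0))) (≤-pred x<n)

EvenAhead : (n : ℕ) → Fin n → Fin n → Set
EvenAhead n u v = Even (forwardDistance n (toℕ u) (toℕ v))

module _ {n : ℕ} (odd : parity n ≡ 1ℙ) {u v : Fin n} (u≢v : u ≢ v) where

  private
    ahead behind : ℕ
    ahead  = forwardDistance n (toℕ u) (toℕ v)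
    behind = forwardDistance n (toℕ v) (toℕ u)

  forwardDistance-odd-sum : parity (ahead + behind) ≡ 1ℙ
  forwardDistance-odd-sum =
    trans (cong parity (forwardDistance-+ (u≢v ∘ toℕ-injective) (toℕ<n u) (toℕ<n v))) odd

  evenAhead-total : EvenAhead n u v ⊎ EvenAhead n v u
  evenAhead-total = odd-sum-even-or-even ahead behind forwardDistance-odd-sum

  evenAhead-asym : EvenAhead n u v → ¬ EvenAhead n v u
  evenAhead-asym = odd-sum-not-even-and-even ahead behind forwardDistance-odd-sum

evenAhead-not-next : ∀ {n} {v u w : Fin n} → w ≢ v → EvenAhead n v u → EvenAhead n v w → ¬ CycNext n u w
evenAhead-not-next {n} {v} {u} w≢v u-even w-even next =
  even-suc-not-even (forwardDistance n (toℕ v) (toℕ u)) u-even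
    (trans (cong parity (sym (forwardDistance-next (toℕ<n v) (w≢v ∘ toℕ-injective) next))) w-even)

-- The construction works for every odd n.
proposition11 : (n k : ℕ) → n ≡ 2 * k + 1 → 3 ≤ n → OnePerfectlyOrientable (CycleComplement n)
proposition11 n k refl _ = D , D-1Perfect
  where
  odd : parity n ≡ 1ℙ
  odd = parity-2*k+1 k

  D : Orientation (CycleComplement n)
  D = restrictedOrientation (CycleComplement n) (EvenAhead n)
        (λ (u≢v , _) → evenAhead-total odd u≢v)
        (λ (u≢v , _) → evenAhead-asym odd u≢v)

  D-1Perfect : Is1Perfect (CycleComplement n) D
  D-1Perfect v u w (v~u , u-even) (v~w , w-even) u≢w = u≢w ,
    [ evenAhead-not-next (λ w≡v → proj₁ v~w (sym w≡v)) u-even w-even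
    , evenAhead-not-next (λ u≡v → proj₁ v~u (sym u≡v)) w-even u-even ]′
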